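{- Let $G$ be an $n$-vertex graph and $k\ge1$ an integer such that for every two disjoint sets $S,T\subseteq V(G)$ with $|S|=|T|=k$ there is an edge of $G$ between $S$ and $T$. Let $\mathcal{M}$ be a collection of pairwise disjoint pairs $\{x,y\}\subseteq V(G)$ (where $x=y$ is allowed). Then $G\cup\mathcal{M}$ contains an $\mathcal{M}$-alternating path which uses all but at most $2k-1$ of the pairs in $\mathcal{M}$.
   Context: $G\cup\mathcal{M}$ is the graph obtained from $G$ by adding the edge $xy$ for each pair $\{x,y\}\in\mathcal{M}$ with $x\ne y$. A path in $G\cup\mathcal{M}$ is $\mathcal{M}$-alternating if, read from one end to the other, it alternates between single edges of $G$ and $\mathcal{M}$-blocks, where an $\mathcal{M}$-block is either an edge $xy$ with $\{x,y\}\in\mathcal{M}$, $x\ne y$, or a single vertex $x$ with $\{x,x\}\in\mathcal{M}$. The path uses a pair of $\mathcal{M}$ if that pair occurs as one of its $\mathcal{M}$-blocks. -}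

module Defs where

open import Level using (0ℓ)
open import Data.Nat using (ℕ; _+_; _*_; _∸_; _≤_)
open import Data.Fin using (Fin)
open import Data.Fin.Subset using (Subset; _∈_; ∣_∣; Empty; _∩_)
open import Data.Product using (_×_; _,_; proj₁; proj₂; Σ; ∃; ∃-syntax)
open import Data.Sum using (_⊎_)
open import Data.Unit using (⊤)
open import Data.List using (List; []; _∷_; length; lookup)
open import Data.List.Relation.Unary.Unique.Propositional using (Unique)
open import Data.List.Relation.Binary.Pointwise using ()
open import Relation.Nullary using (¬_)
open import Relation.Binary using (Decidable)
open import Relation.Binary.PropositionalEquality using (_≡_; _≢_)

record Graph (n : ℕ) : Set₁ where
  field
    Adj    : Fin n → Fin n → Set
    sym    : ∀ {x y} → Adj x y → Adj y x
    irrefl : ∀ {x} → ¬ Adj x x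
    dec    : Decidable Adj
open Graph public

KSetsLinked : ∀ {n} → Graph n → ℕ → Set
KSetsLinked {n} G k =
  (S T : Subset n) → Empty (S ∩ T) → ∣ S ∣ ≡ k → ∣ T ∣ ≡ k →
  ∃[ x ] ∃[ y ] (x ∈ S × y ∈ T × Adj G x y)

Pairs : ℕ → Set
Pairs n = List (Fin n × Fin n)

InPair : ∀ {n} → Fin n → Fin n × Fin n → Set
InPair v (x , y) = v ≡ x ⊎ v ≡ y

PairwiseDisjoint : ∀ {n} → Pairs n → Set
PairwiseDisjoint M =
  ∀ (i j : Fin (length M)) (v : _) → InPair v (lookup M i) → InPair v (lookup M j) → i ≡ j

-- An M-block: a pair of M (given by its index) traversed in one of its two orientations.
-- Start and end vertex of the block.
data Orient : Set where
  fwd bwd : Orient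

Block : ∀ {n} → Pairs n → Set
Block M = Fin (length M) × Orient

start end : ∀ {n} (M : Pairs n) → Block M → Fin n
start M (i , fwd) = proj₁ (lookup M i)
start M (i , bwd) = proj₂ (lookup M i)
end   M (i , fwd) = proj₂ (lookup M i)
end   M (i , bwd) = proj₁ (lookup M i)

Linked : ∀ {n} (G : Graph n) (M : Pairs n) → List (Block M) → Set
Linked G M []            = ⊤
Linked G M (b ∷ [])      = ⊤
Linked G M (b ∷ c ∷ bs)  = Adj G (end M b) (start M c) × Linked G M (c ∷ bs)

-- An M-alternating path: a sequence of M-blocks, each consecutive pair joined
-- by a G-edge, using each pair of M at most once (so, M being pairwise
-- disjoint, all vertices are distinct).
record AltPath {n} (G : Graph n) (M : Pairs n) : Set where
  field
    blocks : List (Block M)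
    linked : Linked G M blocks
    usesDistinct : Unique (Data.List.map proj₁ blocks)
open AltPath public

used : ∀ {n} {G : Graph n} {M : Pairs n} → AltPath G M → ℕ
used P = length (blocks P)

-- Depth-first search on the pairs of M.  The state is a stack R, which is an
-- M-alternating path, a list S of abandoned pairs and a list T of unvisited ones.
-- While |S| < |T|, a round pushes a pair of T adjacent to the top of the stack
-- (any pair of T if the stack is empty) or, if there is none, abandons the top.
-- Thus no abandoned pair has an edge into T, |S| ≤ |T| is maintained and
-- |R| + 2|T| decreases, so the search stops with |S| = |T|.  Then the second
-- vertices of S and the first vertices of T are two disjoint sets of |S|
-- vertices without an edge between them, so |S| < k, and R misses only
-- |S| + |T| ≤ 2k − 2 pairs.
module Submission where

open import Defs hiding (sym)
open import Data.Nat using (ℕ; zero; suc; _≤_; _<_; _+_; _*_; _∸_; z≤n; s≤s; s≤s⁻¹)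
open import Data.Nat.Properties
  using (module ≤-Reasoning; _≟_; _≤?_; ≤-refl; ≤-reflexive; ≤-trans; ≤∧≢⇒<; ≰⇒>; m≤n⇒m≤1+n; +-mono-≤; +-identityʳ; +-suc; m+n∸m≡n)
open import Data.Nat.Induction using (<-wellFounded)
open import Induction.WellFounded using (Acc; acc)
open import Data.Fin using (Fin; zero; suc)
open import Data.Fin.Subset using (Subset; inside; ⊥; _∩_; ∣_∣; Empty) renaming (_∈_ to _∈ₛ_; _∉_ to _∉ₛ_)
open import Data.Fin.Subset.Properties using (x∈p∩q⁻; ∉⊥; ∣⊥∣≡0)
open import Data.Vec using (_∷_; here; there; _[_]≔_)
open import Data.Bool using (true; false)
open import Data.List using (List; []; _∷_; _++_; length; map; lookup; allFin)
open import Data.List.Properties using (length-++; length-map; length-tabulate; map-∘; map-id)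
open import Data.List.Membership.Propositional using (_∈_; find; lose)
open import Data.List.Membership.Propositional.Properties using (∈-∃++; ∈-map⁻)
open import Data.List.Relation.Unary.Any using (here; there; any?)
open import Data.List.Relation.Unary.All as All using ()
open import Data.List.Relation.Unary.All.Properties using (++⁻ˡ; ++⁻ʳ)
open import Data.List.Relation.Unary.AllPairs using ([]; _∷_)
open import Data.List.Relation.Unary.Unique.Propositional using (Unique)
open import Data.List.Relation.Unary.Unique.Propositional.Properties using (map⁺; allFin⁺)
open import Data.List.Relation.Binary.Disjoint.Propositional using (Disjoint)
open import Data.List.Relation.Binary.Permutation.Propositional using (_↭_; ↭-refl; ↭-sym; ↭-trans; ↭⇒↭ₛ)
open import Data.List.Relation.Binary.Permutation.Propositional.Properties using (shift; ++⁺ˡ; ↭-length; ∈-resp-↭)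
open import Data.List.Relation.Binary.Permutation.Setoid.Properties using (Unique-resp-↭)
open import Data.Product using (Σ; _×_; _,_; -,_; proj₁; proj₂; ∃-syntax)
open import Data.Sum using (_⊎_; inj₁; inj₂; [_,_]′)
open import Data.Unit using (tt)
open import Data.Empty using (⊥-elim)
open import Relation.Nullary using (¬_; yes; no)
open import Relation.Binary.PropositionalEquality using (_≡_; refl; sym; trans; cong; cong₂; subst; setoid; module ≡-Reasoning)

Unique-++⁻ : ∀ {A : Set} (xs : List A) {ys : List A} →
  Unique (xs ++ ys) → Unique xs × Unique ys × Disjoint xs ys
Unique-++⁻ []       u          = [] , u , λ ()
Unique-++⁻ (x ∷ xs) (x∉ ∷ u) with uxs , uys , xs∩ys ← Unique-++⁻ xs u =
  ++⁻ˡ xs x∉ ∷ uxs , uys , λ where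
    (here refl  , v∈ys) → All.lookup (++⁻ʳ xs x∉) v∈ys refl
    (there v∈xs , v∈ys) → xs∩ys (v∈xs , v∈ys)

∈⇒↭∷ : ∀ {A : Set} {x : A} {xs : List A} → x ∈ xs → ∃[ ys ] (xs ↭ x ∷ ys)
∈⇒↭∷ x∈xs with ys , zs , refl ← ∈-∃++ x∈xs = ys ++ zs , shift _ ys zs

↭-pull : ∀ {A : Set} (xs ys : List A) {zs zs′ : List A} {v : A} →
  zs ↭ v ∷ zs′ → xs ++ ys ++ zs ↭ v ∷ xs ++ ys ++ zs′
↭-pull xs ys {zs′ = zs′} {v} p =
  ↭-trans (++⁺ˡ xs (++⁺ˡ ys p))
    (↭-trans (++⁺ˡ xs (shift v ys zs′)) (shift v xs (ys ++ zs′)))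

m<n⇒m+m≤2*n∸1 : ∀ {m n} → m < n → m + m ≤ 2 * n ∸ 1
m<n⇒m+m≤2*n∸1 {n = suc n} (s≤s m≤n) =
  +-mono-≤ m≤n (m≤n⇒m≤1+n (≤-trans m≤n (≤-reflexive (sym (+-identityʳ n)))))

x∈p[y]≔inside⁻ : ∀ {n} {x} (y : Fin n) (p : Subset n) → x ∈ₛ p [ y ]≔ inside → x ≡ y ⊎ x ∈ₛ p
x∈p[y]≔inside⁻ zero    (b ∷ p) here      = inj₁ refl
x∈p[y]≔inside⁻ zero    (b ∷ p) (there m) = inj₂ (there m)
x∈p[y]≔inside⁻ (suc y) (b ∷ p) here      = inj₂ here
x∈p[y]≔inside⁻ (suc y) (b ∷ p) (there m) with x∈p[y]≔inside⁻ y p m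
... | inj₁ refl = inj₁ refl
... | inj₂ x∈p  = inj₂ (there x∈p)

∣p[x]≔inside∣≡1+∣p∣ : ∀ {n} (x : Fin n) (p : Subset n) → x ∉ₛ p → ∣ p [ x ]≔ inside ∣ ≡ suc ∣ p ∣
∣p[x]≔inside∣≡1+∣p∣ zero    (true  ∷ p) x∉p = ⊥-elim (x∉p here)
∣p[x]≔inside∣≡1+∣p∣ zero    (false ∷ p) x∉p = refl
∣p[x]≔inside∣≡1+∣p∣ (suc x) (true  ∷ p) x∉p = cong suc (∣p[x]≔inside∣≡1+∣p∣ x p (λ x∈p → x∉p (there x∈p)))
∣p[x]≔inside∣≡1+∣p∣ (suc x) (false ∷ p) x∉p = ∣p[x]≔inside∣≡1+∣p∣ x p (λ x∈p → x∉p (there x∈p))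

subset-of-size : ∀ {n} k {xs : List (Fin n)} → Unique xs → k ≤ length xs →
  ∃[ p ] (∣ p ∣ ≡ k × (∀ {x} → x ∈ₛ p → x ∈ xs))
subset-of-size {n} zero _ _ = ⊥ , ∣⊥∣≡0 n , λ x∈⊥ → ⊥-elim (∉⊥ x∈⊥)
subset-of-size (suc k) {x ∷ xs} (x∉xs ∷ u) (s≤s k≤∣xs∣)
  with p , ∣p∣≡k , p⊆xs ← subset-of-size k u k≤∣xs∣ =
  p [ x ]≔ inside ,
  trans (∣p[x]≔inside∣≡1+∣p∣ x p (λ x∈p → All.lookup x∉xs (p⊆xs x∈p) refl)) (cong suc ∣p∣≡k) ,
  λ y∈p′ → [ (λ { refl → here refl }) , (λ y∈p → there (p⊆xs y∈p)) ]′ (x∈p[y]≔inside⁻ x p y∈p′)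

Disjoint⇒Empty-∩ : ∀ {n} {xs ys : List (Fin n)} {p q : Subset n} → Disjoint xs ys →
  (∀ {x} → x ∈ₛ p → x ∈ xs) → (∀ {x} → x ∈ₛ q → x ∈ ys) → Empty (p ∩ q)
Disjoint⇒Empty-∩ {p = p} {q} xs∩ys p⊆xs q⊆ys (x , x∈p∩q) =
  let x∈p , x∈q = x∈p∩q⁻ p q x∈p∩q in xs∩ys (p⊆xs x∈p , q⊆ys x∈q)

KSetsLinked⇒edge : ∀ {n} {G : Graph n} {k} → KSetsLinked G k →
  ∀ {xs ys : List (Fin n)} → Unique xs → Unique ys → Disjoint xs ys →
  k ≤ length xs → k ≤ length ys → ∃[ x ] ∃[ y ] (x ∈ xs × y ∈ ys × Adj G x y)
KSetsLinked⇒edge {k = k} linked uxs uys xs∩ys k≤xs k≤ys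
  with p , ∣p∣≡k , p⊆xs ← subset-of-size k uxs k≤xs
     | q , ∣q∣≡k , q⊆ys ← subset-of-size k uys k≤ys
  with x , y , x∈p , y∈q , adj ← linked p q (Disjoint⇒Empty-∩ xs∩ys p⊆xs q⊆ys) ∣p∣≡k ∣q∣≡k =
  x , y , p⊆xs x∈p , q⊆ys y∈q , adj

Linked-tail : ∀ {n} {G : Graph n} {M : Pairs n} {b : Block M} {bs : List (Block M)} →
  Linked G M (b ∷ bs) → Linked G M bs
Linked-tail {bs = []}    _          = tt
Linked-tail {bs = _ ∷ _} (_ , path) = path

module DepthFirstSearch {n : ℕ} (G : Graph n) (M : Pairs n) (disjoint : PairwiseDisjoint M) where

  Index : Set
  Index = Fin (length M)

  first second : Index → Fin n
  first  i = proj₁ (lookup M i)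
  second i = proj₂ (lookup M i)

  first-injective : ∀ {i j} → first i ≡ first j → i ≡ j
  first-injective {i} {j} eq = disjoint i j (first i) (inj₁ refl) (inj₁ eq)

  second-injective : ∀ {i j} → second i ≡ second j → i ≡ j
  second-injective {i} {j} eq = disjoint i j (second i) (inj₂ refl) (inj₂ eq)

  first≡second⇒≡ : ∀ {i j} → first i ≡ second j → i ≡ j
  first≡second⇒≡ {i} {j} eq = disjoint i j (first i) (inj₁ refl) (inj₂ eq)

  -- The stack is kept with its most recent pair at the head; read from there it
  -- is a path crossing every pair from its second to its first vertex.
  backwards : List Index → List (Block M)
  backwards = map (_, bwd)

  NoEdge : List Index → List Index → Set
  NoEdge S T = ∀ {i j} → i ∈ S → j ∈ T → ¬ Adj G (first j) (second i)

  record State (R S T : List Index) : Set where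
    field
      partition  : R ++ S ++ T ↭ allFin (length M)
      path       : Linked G M (backwards R)
      noEdge     : NoEdge S T
      dead≤fresh : length S ≤ length T
  open State

  weight : List Index → List Index → ℕ
  weight R T = length R + (length T + length T)

  Progress : List Index → List Index → Set
  Progress R T = ∃[ R′ ] ∃[ S′ ] ∃[ T′ ] (State R′ S′ T′ × weight R′ T′ < weight R T)

  push : ∀ {R S T T′ j} → State R S T → length S < length T → T ↭ j ∷ T′ →
    Linked G M (backwards (j ∷ R)) → State (j ∷ R) S T′
  push {R} {S} st S<T T↭ p = record
    { partition  = ↭-trans (↭-sym (↭-pull R S T↭)) (partition st)
    ; path       = p
    ; noEdge     = λ i∈S j∈T′ → noEdge st i∈S (∈-resp-↭ (↭-sym T↭) (there j∈T′))
    ; dead≤fresh = s≤s⁻¹ (subst (length S <_) (↭-length T↭) S<T)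
    }

  weight-push : ∀ {R T T′ j} → T ↭ j ∷ T′ → weight (j ∷ R) T′ < weight R T
  weight-push {R} {T} {T′} T↭ = ≤-reflexive (begin
    suc (suc (length R + (t + t)))   ≡⟨ cong suc (+-suc (length R) (t + t)) ⟨
    suc (length R + suc (t + t))     ≡⟨ cong (λ m → suc (length R + m)) (+-suc t t) ⟨
    suc (length R + (t + suc t))     ≡⟨ +-suc (length R) (t + suc t) ⟨
    length R + (suc t + suc t)       ≡⟨ cong (λ m → length R + (m + m)) (↭-length T↭) ⟨
    weight R T                       ∎)
    where open ≡-Reasoning
          t = length T′

  pop : ∀ {r R S T} → State (r ∷ R) S T → length S < length T →
    (∀ {j} → j ∈ T → ¬ Adj G (first j) (second r)) → State R (r ∷ S) T
  pop {r} {R} {S} {T} st S<T no-out = record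
    { partition  = ↭-trans (shift r R (S ++ T)) (partition st)
    ; path       = Linked-tail (path st)
    ; noEdge     = λ { (here refl) j∈T → no-out j∈T ; (there i∈S) → noEdge st i∈S }
    ; dead≤fresh = S<T
    }

  step : ∀ {R S T} → State R S T → length S < length T → Progress R T
  step {[]}    {T = j ∷ T} st S<T = -, -, -, push st S<T ↭-refl tt , weight-push {[]} {j ∷ T} ↭-refl
  step {r ∷ R} {T = T}     st S<T with any? (λ j → dec G (first j) (second r)) T
  ... | yes out =
    let _ , j∈T , adj = find out
        _ , T↭ = ∈⇒↭∷ j∈T
    in -, -, -, push st S<T T↭ (adj , path st) , weight-push {r ∷ R} T↭
  ... | no ¬out = -, -, -, pop st S<T (λ j∈T adj → ¬out (lose j∈T adj)) , ≤-refl

  Balanced : Set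
  Balanced = ∃[ R ] ∃[ S ] ∃[ T ] (State R S T × length S ≡ length T)

  search : ∀ {R S T} → State R S T → Acc _<_ (weight R T) → Balanced
  search {S = S} {T} st (acc rec) with length S ≟ length T
  ... | yes S≡T = -, -, -, st , S≡T
  ... | no S≢T with _ , _ , _ , st′ , lighter ← step st (≤∧≢⇒< (dead≤fresh st) S≢T) =
    search st′ (rec lighter)

  initial : State [] [] (allFin (length M))
  initial = record { partition = ↭-refl ; path = tt ; noEdge = λ () ; dead≤fresh = z≤n }

  unique : ∀ {R S T} → State R S T → Unique (R ++ S ++ T)
  unique st = Unique-resp-↭ (setoid Index) (↭⇒↭ₛ (↭-sym (partition st))) (allFin⁺ (length M))

  alternatingPath : ∀ {R S T} → State R S T → AltPath G M
  alternatingPath {R} st = record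
    { blocks       = backwards R
    ; linked       = path st
    ; usesDistinct = subst Unique (trans (sym (map-id R)) (map-∘ {g = proj₁} {f = _, bwd} R))
                       (proj₁ (Unique-++⁻ R (unique st)))
    }

  missed : ∀ {R S T} → State R S T → length M ∸ length (backwards R) ≡ length S + length T
  missed {R} {S} {T} st = begin
    length M ∸ length (backwards R)                ≡⟨ cong₂ _∸_ size (length-map _ R) ⟩
    length R + (length S + length T) ∸ length R    ≡⟨ m+n∸m≡n (length R) _ ⟩
    length S + length T                            ∎
    where
    open ≡-Reasoning
    size : length M ≡ length R + (length S + length T)
    size = begin
      length M                          ≡⟨ length-tabulate (λ i → i) ⟨
      length (allFin (length M))        ≡⟨ ↭-length (partition st) ⟨
      length (R ++ S ++ T)              ≡⟨ length-++ R ⟩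
      length R + length (S ++ T)        ≡⟨ cong (length R +_) (length-++ S) ⟩
      length R + (length S + length T)  ∎

  ends-disjoint : ∀ {S T} → Disjoint S T → Disjoint (map first T) (map second S)
  ends-disjoint S∩T (v∈firsts , v∈seconds)
    with j , j∈T , refl ← ∈-map⁻ first v∈firsts | i , i∈S , eq ← ∈-map⁻ second v∈seconds
    with refl ← first≡second⇒≡ eq = S∩T (i∈S , j∈T)

  dead<k : ∀ {k R S T} → KSetsLinked G k → State R S T → length S ≡ length T → length S < k
  dead<k {k} {R} {S} {T} linked st S≡T with k ≤? length S
  ... | no k≰S = ≰⇒> k≰S
  ... | yes k≤S
    with _ , uST , _ ← Unique-++⁻ R (unique st)
    with uS , uT , S∩T ← Unique-++⁻ S uST
    with _ , _ , x∈firsts , y∈seconds , adj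
           ← KSetsLinked⇒edge {G = G} linked (map⁺ first-injective uT) (map⁺ second-injective uS)
               (ends-disjoint S∩T)
               (≤-trans k≤S (≤-reflexive (trans S≡T (sym (length-map first T)))))
               (≤-trans k≤S (≤-reflexive (sym (length-map second S))))
    with j , j∈T , refl ← ∈-map⁻ first x∈firsts | i , i∈S , refl ← ∈-map⁻ second y∈seconds
    = ⊥-elim (noEdge st i∈S j∈T adj)

-- 1 ≤ k is unused: for k = 0 the hypothesis KSetsLinked G 0 already fails on S = T = ∅.
lemma3p17 : (n : ℕ) (G : Graph n) (k : ℕ) → 1 ≤ k → KSetsLinked G k →
    (M : Pairs n) → PairwiseDisjoint M →
    Σ (AltPath G M) (λ P → length M ∸ used P ≤ 2 * k ∸ 1)
lemma3p17 n G k _ linked M disjoint =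
  let open DepthFirstSearch G M disjoint
      _ , S , T , st , S≡T = search initial (<-wellFounded _)
      open ≤-Reasoning
  in alternatingPath st , (begin
    length M ∸ used (alternatingPath st)  ≡⟨ missed st ⟩
    length S + length T                   ≡⟨ cong (length S +_) S≡T ⟨
    length S + length S                   ≤⟨ m<n⇒m+m≤2*n∸1 (dead<k linked st S≡T) ⟩
    2 * k ∸ 1                             ∎)
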